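{- Fix an initial parameter $\gamma_0>1$ and a bucket limit $m\ge 1$. Let $\mathcal{D}$ be a finite multiset of positive reals, presented as an insertion-only stream (each element of $\mathcal{D}$ is inserted once per occurrence, and no deletions occur). Then the sketch produced by UDDSketch (with initial parameter $\gamma_0$ and bucket limit $m$) after processing the stream — that is, the final value of $\gamma$ together with the set of bucket keys and their counters — is the same for every ordering of the elements of $\mathcal{D}$ in the stream.
   Context: UDDSketch. A sketch consists of a parameter $\gamma>1$ and a finite collection of buckets $B_i$, $i\in\mathbb{Z}$, each an integer counter; only buckets with nonzero counter are kept, and the size of the sketch is the number of kept buckets. An item $x>0$ belongs to bucket $i=\lceil \log_\gamma x\rceil$ (i.e. $\gamma^{i-1}<x\le\gamma^i$). Initially the sketch is empty and $\gamma=\gamma_0$. Inserting $x$ increments $B_{\lceil\log_\gamma x\rceil}$ by one (creating the bucket with count $1$ if absent). Deleting $x$ decrements that counter, and a bucket whose counter reaches $0$ is removed. Uniform collapse: every bucket $B_i$ is replaced by contributing its count to a new bucket with key $\lceil i/2\rceil$ (so buckets $2j-1$ and $2j$ are combined into bucket $j$), and $\gamma$ is replaced by $\gamma^2$; the new bucket $j$ then consists exactly of the items $x$ with $\lceil\log_{\gamma^2}x\rceil=j$. Whenever the size of the sketch exceeds $m$, uniform collapses are performed until the size is at most $m$. -}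

module Defs where

open import Data.Nat using (ℕ; zero; suc; _+_; _≤_; _<_; ⌊_/2⌋; ⌈_/2⌉)
open import Data.Integer using (ℤ; +_; -[1+_]; -_)
import Data.Integer as ℤ
open import Data.List using (List; []; _∷_; length)
open import Data.Product using (_×_; _,_)
open import Relation.Nullary using (yes; no)

ceilHalf : ℤ → ℤ
ceilHalf (+ n)      = + ⌈ n /2⌉
ceilHalf -[1+ n ]   = - (+ ⌊ suc n /2⌋)

-- A bucket store: association list of (key , counter); only nonzero
-- counters are ever stored and keys are kept distinct by the operations.
Buckets : Set
Buckets = List (ℤ × ℕ)

count : Buckets → ℤ → ℕ
count []             i = 0
count ((j , c) ∷ bs) i with j ℤ.≟ i
... | yes _ = c
... | no  _ = count bs i

size : Buckets → ℕ
size = length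

addTo : ℤ → ℕ → Buckets → Buckets
addTo j c []               = (j , c) ∷ []
addTo j c ((i , d) ∷ bs) with i ℤ.≟ j
... | yes _ = (i , d + c) ∷ bs
... | no  _ = (i , d) ∷ addTo j c bs

collapseBuckets : Buckets → Buckets
collapseBuckets []             = []
collapseBuckets ((i , c) ∷ bs) = addTo (ceilHalf i) c (collapseBuckets bs)

-- A sketch state: the number k of collapses performed so far
-- (so that γ = γ₀^(2^k)) together with the buckets.
State : Set
State = ℕ × Buckets

initial : State
initial = (0 , [])

-- The algorithm, parameterised by the item type X, the bucket function
-- key k x = ⌈ log_{γ₀^(2^k)} x ⌉ (bucket of x when γ = γ₀^(2^k)), and
-- the bucket limit m.
module UDD (X : Set) (key : ℕ → X → ℤ) (m : ℕ) where

  insert : X → State → State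
  insert x (k , bs) = (k , addTo (key k x) 1 bs)

  uniformCollapse : State → State
  uniformCollapse (k , bs) = (suc k , collapseBuckets bs)

  data Collapses : State → State → Set where
    done : ∀ {k bs} → size bs ≤ m → Collapses (k , bs) (k , bs)
    step : ∀ {k bs t} → m < size bs →
           Collapses (uniformCollapse (k , bs)) t → Collapses (k , bs) t

  data Process : State → List X → State → Set where
    nil  : ∀ {s} → Process s [] s
    cons : ∀ {s x xs t u} → Collapses (insert x s) t →
           Process t xs u → Process s (x ∷ xs) u

-- A bucket store is a multiset of keys, and at level k the keys of a stream P form the multiset
-- map (key k) P, since collapsing maps each key through ⌈_/2⌉ exactly as passing from key k to
-- key (suc k) does. Among well-formed stores (distinct keys, positive counters) the multiset
-- determines the counters, and the number of distinct keys determines the size; this size grows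
-- with the stream. Hence, after any prefix, the level k of the sketch is the least level whose
-- key set has at most m elements: insertions can only push that least level up, and collapses
-- stop exactly when it is reached. Both k and the counters thus depend only on the multiset of
-- items read, which is invariant under permutation.
module Submission where

open import Defs
open import Data.Nat using (ℕ; suc; _≤_; _<_; _+_; z≤n; s≤s)
open import Data.Nat.Properties using (≤-antisym; ≤-trans; ≮⇒≥; <⇒≱; m≤m+n; m<1+n⇒m<n∨m≡n)
open import Data.Integer using (ℤ; _≟_)
open import Data.List using (List; []; _∷_; _++_; map; replicate; length; filter)
open import Data.List.Properties
  using (length-map; ++-assoc; length-replicate; ++-identityʳ; map-++; map-replicate; filter-++; filter-all; filter-none)
open import Data.List.Membership.Propositional using (_∈_)
open import Data.List.Membership.Propositional.Properties using (∈-∃++; ∈-++⁻; ∈-++⁺ˡ; ∈-++⁺ʳ)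
open import Data.List.Relation.Binary.Subset.Propositional using (_⊆_)
import Data.List.Relation.Binary.Subset.Propositional.Properties as ⊆
open import Data.List.Relation.Binary.Permutation.Propositional
  using (_↭_; ↭-refl; ↭-sym; ↭-trans; ↭-reflexive; prep)
open import Data.List.Relation.Binary.Permutation.Propositional.Properties
  using (map⁺; ++⁺ˡ; shift; shifts; filter-↭; ↭-length)
open import Data.List.Relation.Unary.All using (All; []; _∷_)
import Data.List.Relation.Unary.All as All
import Data.List.Relation.Unary.All.Properties as All
open import Data.List.Relation.Unary.AllPairs using ([]; _∷_)
open import Data.List.Relation.Unary.Any using (here; there)
open import Data.List.Relation.Unary.Unique.Propositional using (Unique)
open import Data.Product using (_×_; _,_; proj₁; proj₂; ∃)
open import Data.Sum using (inj₁; inj₂)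
open import Data.Empty using (⊥-elim)
open import Function using (_∘_)
open import Relation.Binary.PropositionalEquality
  using (_≡_; refl; sym; trans; cong; cong₂; subst; subst₂; ≢-sym; module ≡-Reasoning)
open import Relation.Nullary using (yes; no)

Unique⊆⇒length≤ : ∀ {A : Set} {xs ys : List A} → Unique xs → xs ⊆ ys → length xs ≤ length ys
Unique⊆⇒length≤ {xs = []} _ _ = z≤n
Unique⊆⇒length≤ {xs = x ∷ xs} (x∉xs ∷ uxs) xs⊆ys with ∈-∃++ (xs⊆ys (here refl))
... | ys₁ , ys₂ , refl =
  subst (length (x ∷ xs) ≤_) (sym (↭-length (shift x ys₁ ys₂)))
    (s≤s (Unique⊆⇒length≤ uxs xs⊆ys₁++ys₂))
  where
  xs⊆ys₁++ys₂ : xs ⊆ ys₁ ++ ys₂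
  xs⊆ys₁++ys₂ y∈xs with ∈-++⁻ ys₁ (xs⊆ys (there y∈xs))
  ... | inj₁ y∈ys₁        = ∈-++⁺ˡ y∈ys₁
  ... | inj₂ (here y≡x)   = ⊥-elim (All.lookup x∉xs y∈xs (sym y≡x))
  ... | inj₂ (there y∈ys₂) = ∈-++⁺ʳ ys₁ y∈ys₂

keys : Buckets → List ℤ
keys = map proj₁

expand : Buckets → List ℤ
expand []             = []
expand ((i , c) ∷ bs) = replicate c i ++ expand bs

WellFormed : Buckets → Set
WellFormed bs = Unique (keys bs) × All (λ b → 0 < proj₂ b) bs

∈-replicate : ∀ {A : Set} {x y : A} n → x ∈ replicate n y → x ≡ y
∈-replicate (suc n) (here x≡y)  = x≡y
∈-replicate (suc n) (there x∈) = ∈-replicate n x∈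

expand⊆keys : ∀ bs → expand bs ⊆ keys bs
expand⊆keys ((i , c) ∷ bs) x∈ with ∈-++⁻ (replicate c i) x∈
... | inj₁ x∈rep = here (∈-replicate c x∈rep)
... | inj₂ x∈bs  = there (expand⊆keys bs x∈bs)

keys⊆expand : ∀ {bs} → All (λ b → 0 < proj₂ b) bs → keys bs ⊆ expand bs
keys⊆expand {(i , suc c) ∷ bs} _        (here refl)  = here refl
keys⊆expand {(i , c) ∷ bs}     (_ ∷ ps) (there x∈bs) = ∈-++⁺ʳ (replicate c i) (keys⊆expand ps x∈bs)

All-expand : ∀ {P : ℤ → Set} bs → All P (keys bs) → All P (expand bs)
All-expand []             []         = []
All-expand ((i , c) ∷ bs) (pi ∷ pbs) = All.++⁺ (All.replicate⁺ c pi) (All-expand bs pbs)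

size-mono : ∀ {bs bs′} → WellFormed bs → expand bs ⊆ expand bs′ → size bs ≤ size bs′
size-mono {bs} {bs′} (u , pos) sub =
  subst₂ _≤_ (length-map proj₁ bs) (length-map proj₁ bs′)
    (Unique⊆⇒length≤ u (expand⊆keys bs′ ∘ sub ∘ keys⊆expand pos))

count-expand : ∀ bs → Unique (keys bs) → ∀ i → count bs i ≡ length (filter (_≟ i) (expand bs))
count-expand []             _            i = refl
count-expand ((j , c) ∷ bs) (j∉bs ∷ ubs) i with j ≟ i
... | yes refl = sym (begin
  length (filter (_≟ j) (replicate c j ++ expand bs))
    ≡⟨ cong length (filter-++ (_≟ j) (replicate c j) (expand bs)) ⟩
  length (filter (_≟ j) (replicate c j) ++ filter (_≟ j) (expand bs))
    ≡⟨ cong₂ (λ l l′ → length (l ++ l′))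
             (filter-all (_≟ j) (All.replicate⁺ c refl))
             (filter-none (_≟ j) (All.map ≢-sym (All-expand bs j∉bs))) ⟩
  length (replicate c j ++ [])
    ≡⟨ cong length (++-identityʳ (replicate c j)) ⟩
  length (replicate c j)
    ≡⟨ length-replicate c ⟩
  c ∎)
  where open ≡-Reasoning
... | no j≢i = begin
  count bs i
    ≡⟨ count-expand bs ubs i ⟩
  length (filter (_≟ i) (expand bs))
    ≡⟨ cong (λ l → length (l ++ filter (_≟ i) (expand bs))) (filter-none (_≟ i) (All.replicate⁺ c j≢i)) ⟨
  length (filter (_≟ i) (replicate c j) ++ filter (_≟ i) (expand bs))
    ≡⟨ cong length (filter-++ (_≟ i) (replicate c j) (expand bs)) ⟨
  length (filter (_≟ i) (expand ((j , c) ∷ bs))) ∎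
  where open ≡-Reasoning

count-cong : ∀ {bs bs′} → Unique (keys bs) → Unique (keys bs′) →
             expand bs ↭ expand bs′ → ∀ i → count bs i ≡ count bs′ i
count-cong {bs} {bs′} u u′ bs↭bs′ i =
  trans (count-expand bs u i)
    (trans (↭-length (filter-↭ (_≟ i) bs↭bs′)) (sym (count-expand bs′ u′ i)))

replicate-+ : ∀ {A : Set} m n (x : A) → replicate (m + n) x ≡ replicate m x ++ replicate n x
replicate-+ 0       n x = refl
replicate-+ (suc m) n x = cong (x ∷_) (replicate-+ m n x)

expand-addTo : ∀ j c bs → expand (addTo j c bs) ↭ replicate c j ++ expand bs
expand-addTo j c []             = ↭-refl
expand-addTo j c ((i , d) ∷ bs) with i ≟ j
... | yes refl = ↭-trans
  (↭-reflexive (trans (cong (_++ expand bs) (replicate-+ d c i)) (++-assoc (replicate d i) _ _)))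
  (shifts (replicate d i) (replicate c i))
... | no _ = ↭-trans (++⁺ˡ (replicate d i) (expand-addTo j c bs)) (shifts (replicate d i) (replicate c j))

expand-collapse : ∀ bs → expand (collapseBuckets bs) ↭ map ceilHalf (expand bs)
expand-collapse []             = ↭-refl
expand-collapse ((i , c) ∷ bs) =
  ↭-trans (expand-addTo (ceilHalf i) c (collapseBuckets bs))
  (↭-trans (++⁺ˡ (replicate c (ceilHalf i)) (expand-collapse bs))
    (↭-reflexive (sym (trans (map-++ ceilHalf (replicate c i) (expand bs))
                              (cong (_++ _) (map-replicate ceilHalf c i))))))

All-keys-addTo : ∀ {P : ℤ → Set} j c bs → All P (keys bs) → P j → All P (keys (addTo j c bs))
All-keys-addTo j c []             _          pj = pj ∷ []
All-keys-addTo j c ((i , d) ∷ bs) (pi ∷ pbs) pj with i ≟ j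
... | yes _ = pi ∷ pbs
... | no  _ = pi ∷ All-keys-addTo j c bs pbs pj

wellFormed-addTo : ∀ j {c} bs → 0 < c → WellFormed bs → WellFormed (addTo j c bs)
wellFormed-addTo j []             0<c _                    = [] ∷ [] , 0<c ∷ []
wellFormed-addTo j {c} ((i , d) ∷ bs) 0<c (i∉bs ∷ u , 0<d ∷ pos) with i ≟ j
... | yes _   = i∉bs ∷ u , ≤-trans 0<d (m≤m+n d c) ∷ pos
... | no  i≢j =
  let u′ , pos′ = wellFormed-addTo j bs 0<c (u , pos)
  in All-keys-addTo j c bs i∉bs i≢j ∷ u′ , 0<d ∷ pos′

wellFormed-collapse : ∀ {bs} → All (λ b → 0 < proj₂ b) bs → WellFormed (collapseBuckets bs)
wellFormed-collapse {[]}           []         = [] , []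
wellFormed-collapse {(i , c) ∷ bs} (0<c ∷ pos) =
  wellFormed-addTo (ceilHalf i) (collapseBuckets bs) 0<c (wellFormed-collapse pos)

module Invariant (X : Set) (key : ℕ → X → ℤ)
                 (key-suc : ∀ k x → key (suc k) x ≡ ceilHalf (key k x)) (m : ℕ) where
  open UDD X key m

  Represents : ℕ → List X → Buckets → Set
  Represents k P bs = WellFormed bs × expand bs ↭ map (key k) P

  represents-resp-↭ : ∀ {k P Q bs} → P ↭ Q → Represents k P bs → Represents k Q bs
  represents-resp-↭ P↭Q (wf , e) = wf , ↭-trans e (map⁺ _ P↭Q)

  represents-insert : ∀ {k P bs} x → Represents k P bs → Represents k (x ∷ P) (addTo (key k x) 1 bs)
  represents-insert {k} {bs = bs} x (wf , e) =
    wellFormed-addTo (key k x) bs (s≤s z≤n) wf , ↭-trans (expand-addTo (key k x) 1 bs) (prep _ e)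

  map-key-suc : ∀ k P → map ceilHalf (map (key k) P) ≡ map (key (suc k)) P
  map-key-suc k []      = refl
  map-key-suc k (x ∷ P) = cong₂ _∷_ (sym (key-suc k x)) (map-key-suc k P)

  represents-collapse : ∀ {k P bs} → Represents k P bs → Represents (suc k) P (collapseBuckets bs)
  represents-collapse {k} {P} {bs} ((_ , pos) , e) =
    wellFormed-collapse pos ,
    ↭-trans (expand-collapse bs) (↭-trans (map⁺ ceilHalf e) (↭-reflexive (map-key-suc k P)))

  represents-exists : ∀ k P → ∃ (Represents k P)
  represents-exists k []      = [] , ([] , []) , ↭-refl
  represents-exists k (x ∷ P) =
    let bs , r = represents-exists k P in addTo (key k x) 1 bs , represents-insert x r

  represents-size-mono : ∀ {k P Q bs bs′} → Represents k P bs → Represents k Q bs′ → P ⊆ Q →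
                         size bs ≤ size bs′
  represents-size-mono {bs′ = bs′} (wf , e) (_ , e′) P⊆Q =
    size-mono {bs′ = bs′} wf (⊆.⊆-reflexive-↭ (↭-sym e′) ∘ ⊆.map⁺ _ P⊆Q ∘ ⊆.⊆-reflexive-↭ e)

  Overflows : ℕ → List X → Set
  Overflows k P = ∀ bs → Represents k P bs → m < size bs

  overflows : ∀ {k P bs} → Represents k P bs → m < size bs → Overflows k P
  overflows r m<size bs′ r′ = ≤-trans m<size (represents-size-mono r r′ (λ x∈ → x∈))

  overflows-mono : ∀ {k P Q} → P ⊆ Q → Overflows k P → Overflows k Q
  overflows-mono {k} {P} P⊆Q over bs′ r′ =
    let bs , r = represents-exists k P in ≤-trans (over bs r) (represents-size-mono r r′ P⊆Q)

  -- Characterises the states reachable by reading the items of P in some order.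
  Settled : State → List X → Set
  Settled (k , bs) P = Represents k P bs × size bs ≤ m × (∀ j → j < k → Overflows j P)

  settled-resp-↭ : ∀ {s P Q} → P ↭ Q → Settled s P → Settled s Q
  settled-resp-↭ P↭Q (r , ≤m , below) =
    represents-resp-↭ P↭Q r , ≤m , λ j j<k → overflows-mono (⊆.⊆-reflexive-↭ P↭Q) (below j j<k)

  settled-collapses : ∀ {k bs t P} → Collapses (k , bs) t → Represents k P bs →
                      (∀ j → j < k → Overflows j P) → Settled t P
  settled-collapses (done ≤m)       r below = r , ≤m , below
  settled-collapses (step m<size c) r below = settled-collapses c (represents-collapse r) below′
    where
    below′ : ∀ j → j < suc _ → Overflows j _
    below′ j j<1+k with m<1+n⇒m<n∨m≡n j<1+k
    ... | inj₁ j<k  = below j j<k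
    ... | inj₂ refl = overflows r m<size

  settled-process : ∀ {s xs u P} → Settled s P → Process s xs u → Settled u (xs ++ P)
  settled-process st nil = st
  settled-process {xs = x ∷ xs} {P = P} (r , _ , below) (cons c run) =
    settled-resp-↭ (shift x xs P)
      (settled-process (settled-collapses c (represents-insert x r)
                          (λ j j<k → overflows-mono (⊆.xs⊆x∷xs P x) (below j j<k))) run)

  settled-run : ∀ {xs u} → Process initial xs u → Settled u xs
  settled-run {xs} run =
    settled-resp-↭ (↭-reflexive (++-identityʳ xs)) (settled-process ((([] , []) , ↭-refl) , z≤n , λ _ ()) run)

  settled-level-≤ : ∀ {k k′ bs bs′ P} → Settled (k , bs) P → Settled (k′ , bs′) P → k ≤ k′
  settled-level-≤ {bs′ = bs′} (_ , _ , below) (r′ , ≤m′ , _) =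
    ≮⇒≥ (λ k′<k → <⇒≱ (below _ k′<k bs′ r′) ≤m′)

  settled-unique : ∀ {k k′ bs bs′ P} → Settled (k , bs) P → Settled (k′ , bs′) P →
                   k ≡ k′ × (∀ i → count bs i ≡ count bs′ i)
  settled-unique st st′ with ≤-antisym (settled-level-≤ st st′) (settled-level-≤ st′ st)
  settled-unique ((wf , e) , _) ((wf′ , e′) , _) | refl =
    refl , count-cong (proj₁ wf) (proj₁ wf′) (↭-trans e (↭-sym e′))

lemma1 : (X : Set) (key : ℕ → X → ℤ)
    → (∀ k x → key (suc k) x ≡ ceilHalf (key k x))
    → (m : ℕ) → 1 ≤ m
    → (xs ys : List X) → xs ↭ ys
    → (k k′ : ℕ) (S S′ : Buckets)
    → UDD.Process X key m initial xs (k , S)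
    → UDD.Process X key m initial ys (k′ , S′)
    → k ≡ k′ × (∀ (i : ℤ) → count S i ≡ count S′ i)
lemma1 X key key-suc m _ xs ys xs↭ys k k′ S S′ run run′ =
  settled-unique (settled-resp-↭ xs↭ys (settled-run run)) (settled-run run′)
  where open Invariant X key key-suc m
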